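{- Let $G$ be a finite group and $X\subseteq G$ a relative difference set with parameters $(m,n,k,\lambda)$ and forbidden subgroup $N$. Then $X$ is i-commuting if and only if $\underline{X}\cdot\underline{N}=\underline{N}\cdot\underline{X}$ in $\mathbb{Z}G$.
   Context: For $X\subseteq G$, $\underline{X}=\sum_{x\in X}x\in\mathbb{Z}G$, $X^{(-1)}=\{x^{ -1}:x\in X\}$, $e$ the identity. For $N\leq G$ (not necessarily normal), $X$ is a relative difference set relative to $N$ with parameters $(m,n,k,\lambda)$ if $\underline{X}\cdot\underline{X^{(-1)}}=ke+\lambda(\underline{G}-\underline{N})$, $k=|X|$, $m=|G:N|$, $n=|N|$, $\lambda$ a positive integer. $X$ is i-commuting if $\underline{X}\cdot\underline{X^{(-1)}}=\underline{X^{(-1)}}\cdot\underline{X}$. -}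

module Defs where

open import Level using (Level; suc; _⊔_)
open import Data.Bool using (Bool; true; false; if_then_else_)
import Data.Bool
open import Data.Nat as ℕ using (ℕ)
open import Data.Integer as ℤ using (ℤ; +_; _+_; _*_; _-_)
open import Data.List using (List; map; foldr; filter; length)
open import Data.List.Membership.Propositional using (_∈_)
open import Data.List.Relation.Unary.Unique.Propositional using (Unique)
open import Relation.Binary.PropositionalEquality using (_≡_)
open import Relation.Binary.Definitions using (DecidableEquality)
open import Relation.Nullary.Decidable using (does)

record FiniteGroup (c : Level) : Set (suc c) where
  infixl 7 _∙_
  field
    Carrier  : Set c
    _∙_      : Carrier → Carrier → Carrier
    e        : Carrier
    inv      : Carrier → Carrier
    assoc    : ∀ x y z → (x ∙ y) ∙ z ≡ x ∙ (y ∙ z)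
    identityˡ : ∀ x → e ∙ x ≡ x
    identityʳ : ∀ x → x ∙ e ≡ x
    inverseˡ : ∀ x → inv x ∙ x ≡ e
    inverseʳ : ∀ x → x ∙ inv x ≡ e
    _≟_      : DecidableEquality Carrier
    elems    : List Carrier
    elems-unique   : Unique elems
    elems-complete : ∀ x → x ∈ elems

module _ {c : Level} (G : FiniteGroup c) where
  open FiniteGroup G

  Subset : Set c
  Subset = Carrier → Bool

  card : Subset → ℕ
  card X = length (filter (λ g → X g Data.Bool.≟ true) elems)

  order : ℕ
  order = length elems

  record IsSubgroup (N : Subset) : Set c where
    field
      has-e   : N e ≡ true
      ∙-closed : ∀ x y → N x ≡ true → N y ≡ true → N (x ∙ y) ≡ true
      inv-closed : ∀ x → N x ≡ true → N (inv x) ≡ true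

  -- the integral group ring ℤG: functions G → ℤ (G finite, so finitely supported)
  ℤG : Set c
  ℤG = Carrier → ℤ

  _≈G_ : ℤG → ℤG → Set c
  a ≈G b = ∀ g → a g ≡ b g

  ΣG : (Carrier → ℤ) → ℤ
  ΣG f = foldr (λ g acc → f g + acc) (+ 0) elems

  infixl 7 _⋆_
  infixl 6 _⊕_ _⊖_
  infixr 8 _·_
  infix 4 _≈G_
  _⋆_ : ℤG → ℤG → ℤG
  (a ⋆ b) g = ΣG (λ h → a h * b (inv h ∙ g))

  _⊕_ : ℤG → ℤG → ℤG
  (a ⊕ b) g = a g + b g

  _⊖_ : ℤG → ℤG → ℤG
  (a ⊖ b) g = a g - b g

  _·_ : ℤ → ℤG → ℤG
  (z · a) g = z * a g

  eG : ℤG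
  eG g = if does (g ≟ e) then + 1 else + 0

  -- underline X = Σ_{x ∈ X} x
  ⟦_⟧ : Subset → ℤG
  ⟦ X ⟧ g = if X g then + 1 else + 0

  _⁻¹ˢ : Subset → Subset
  (X ⁻¹ˢ) g = X (inv g)

  fullSet : Subset
  fullSet _ = true

  record IsRDS (N X : Subset) (m n k lam : ℕ) : Set c where
    field
      N-subgroup : IsSubgroup N
      k-card     : k ≡ card X
      n-card     : n ≡ card N
      m-index    : m ℕ.* n ≡ order
      λ-pos      : 1 ℕ.≤ lam
      rds-eq     : (⟦ X ⟧ ⋆ ⟦ X ⁻¹ˢ ⟧) ≈G (((+ k) · eG) ⊕ ((+ lam) · (⟦ fullSet ⟧ ⊖ ⟦ N ⟧)))

  IsICommuting : Subset → Set c
  IsICommuting X = (⟦ X ⟧ ⋆ ⟦ X ⁻¹ˢ ⟧) ≈G (⟦ X ⁻¹ˢ ⟧ ⋆ ⟦ X ⟧)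

{-# OPTIONS --safe #-}
-- Write x = X̲, ν = N̲ and R = k e + λ(G̲ − ν), so that x x⁽⁻¹⁾ = R. As G̲ is central and λ ≠ 0, an
-- element commutes with R iff it commutes with ν. If x x⁽⁻¹⁾ = x⁽⁻¹⁾ x, then x commutes with
-- x x⁽⁻¹⁾ = R, hence with ν. Conversely, if x commutes with ν then so does x⁽⁻¹⁾ (apply the
-- anti-involution a ↦ a⁽⁻¹⁾, which fixes ν), hence with R = x x⁽⁻¹⁾; as the trace
-- form (b b⁽⁻¹⁾)(e) = Σ_h b(h)² is positive definite, this forces x x⁽⁻¹⁾ = x⁽⁻¹⁾ x.
module Submission where

open import Defs
open import Level using (Level)
open import Algebra.Bundles using (Group; AbelianGroup)
import Algebra.Properties.Group as GroupProperties
open import Data.Bool using (true; if_then_else_)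
open import Data.Bool.Properties using (⇔→≡)
open import Data.Integer using (ℤ; +_; _+_; _*_; _-_; ∣_∣; -[1+_]; NonZero)
import Data.Integer.Properties as ℤ
open import Data.Integer.Tactic.RingSolver using (solve-∀)
open import Data.List using (List; []; _∷_; foldr; map)
open import Data.List.Membership.Propositional using (_∈_)
open import Data.List.Relation.Unary.All using (All; []; _∷_; lookup)
open import Data.List.Relation.Unary.AllPairs using (_∷_)
open import Data.List.Relation.Unary.Any using (here; there)
open import Data.List.Relation.Unary.Unique.Propositional using (Unique)
open import Data.Nat as ℕ using (ℕ)
open import Data.Nat.ListAction using (sum)
import Data.Nat.Properties as ℕ
open import Data.Product using (_×_; _,_)
open import Data.Sum using (reduce)
open import Function using (_∘_; _⇔_; mk⇔; Equivalence)
open import Relation.Binary.PropositionalEquality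
  using (_≡_; _≢_; refl; sym; trans; cong; cong₂; subst; isEquivalence; _→-setoid_; module ≡-Reasoning)
open import Relation.Binary.Bundles using (Setoid)
open import Relation.Nullary.Decidable using (does; dec-true; dec-false)
import Relation.Binary.Reasoning.Setoid as SetoidReasoning

private variable
  a b : Level
  I : Set a
  J : Set b

open GroupProperties (AbelianGroup.group ℤ.+-0-abelianGroup) using () renaming (∙-cancelˡ to +-cancelˡ)

affine-injective : ∀ x y l .{{_ : NonZero l}} {p q} → x + l * (y - p) ≡ x + l * (y - q) → p ≡ q
affine-injective x y l eq = ℤ.neg-injective (+-cancelˡ y _ _ (ℤ.*-cancelˡ-≡ l _ _ (+-cancelˡ x _ _ eq)))

square≡+∣∣*∣∣ : ∀ i → i * i ≡ + (∣ i ∣ ℕ.* ∣ i ∣)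
square≡+∣∣*∣∣ (+ ℕ.zero)  = refl
square≡+∣∣*∣∣ (+ ℕ.suc n) = refl
square≡+∣∣*∣∣ -[1+ n ]    = refl

∑ : List I → (I → ℤ) → ℤ
∑ l f = foldr (λ x acc → f x + acc) (+ 0) l

∑-cong : ∀ (l : List I) {f f′ : I → ℤ} → (∀ x → f x ≡ f′ x) → ∑ l f ≡ ∑ l f′
∑-cong []      f≗f′ = refl
∑-cong (x ∷ l) f≗f′ = cong₂ _+_ (f≗f′ x) (∑-cong l f≗f′)

∑-zero : ∀ (l : List I) → ∑ l (λ _ → + 0) ≡ + 0
∑-zero []      = refl
∑-zero (x ∷ l) = trans (ℤ.+-identityˡ _) (∑-zero l)

∑-+ : ∀ (l : List I) (f f′ : I → ℤ) → ∑ l (λ x → f x + f′ x) ≡ ∑ l f + ∑ l f′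
∑-+ []      f f′ = refl
∑-+ (x ∷ l) f f′ =
  trans (cong (_+_ (f x + f′ x)) (∑-+ l f f′)) (middleFour (f x) (f′ x) (∑ l f) (∑ l f′))
  where
  middleFour : ∀ p q r s → (p + q) + (r + s) ≡ (p + r) + (q + s)
  middleFour = solve-∀

∑-- : ∀ (l : List I) (f f′ : I → ℤ) → ∑ l (λ x → f x - f′ x) ≡ ∑ l f - ∑ l f′
∑-- []      f f′ = refl
∑-- (x ∷ l) f f′ =
  trans (cong (_+_ (f x - f′ x)) (∑-- l f f′)) (middleFour (f x) (f′ x) (∑ l f) (∑ l f′))
  where
  middleFour : ∀ p q r s → (p - q) + (r - s) ≡ (p + r) - (q + s)
  middleFour = solve-∀

∑-*ˡ : ∀ (l : List I) z (f : I → ℤ) → ∑ l (λ x → z * f x) ≡ z * ∑ l f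
∑-*ˡ []      z f = sym (ℤ.*-zeroʳ z)
∑-*ˡ (x ∷ l) z f = trans (cong (_+_ (z * f x)) (∑-*ˡ l z f)) (sym (ℤ.*-distribˡ-+ z (f x) (∑ l f)))

∑-*ʳ : ∀ (l : List I) z (f : I → ℤ) → ∑ l (λ x → f x * z) ≡ ∑ l f * z
∑-*ʳ []      z f = sym (ℤ.*-zeroˡ z)
∑-*ʳ (x ∷ l) z f = trans (cong (_+_ (f x * z)) (∑-*ʳ l z f)) (sym (ℤ.*-distribʳ-+ z (f x) (∑ l f)))

∑-linear : ∀ (l : List I) z w (f p q : I → ℤ) →
           ∑ l (λ x → z * f x + w * (p x - q x)) ≡ z * ∑ l f + w * (∑ l p - ∑ l q)
∑-linear l z w f p q = begin
  ∑ l (λ x → z * f x + w * (p x - q x))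
    ≡⟨ ∑-+ l (λ x → z * f x) (λ x → w * (p x - q x)) ⟩
  ∑ l (λ x → z * f x) + ∑ l (λ x → w * (p x - q x))
    ≡⟨ cong₂ _+_ (∑-*ˡ l z f) (∑-*ˡ l w (λ x → p x - q x)) ⟩
  z * ∑ l f + w * ∑ l (λ x → p x - q x)
    ≡⟨ cong (λ t → z * ∑ l f + w * t) (∑-- l p q) ⟩
  z * ∑ l f + w * (∑ l p - ∑ l q)
    ∎
  where open ≡-Reasoning

∑-swap : ∀ (l : List I) (l′ : List J) (F : I → J → ℤ) →
         ∑ l (λ x → ∑ l′ (F x)) ≡ ∑ l′ (λ y → ∑ l (λ x → F x y))
∑-swap []      l′ F = sym (∑-zero l′)
∑-swap (x ∷ l) l′ F = trans (cong (_+_ (∑ l′ (F x))) (∑-swap l l′ F)) (sym (∑-+ l′ (F x) _))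

module _ {x : I} {f : I → ℤ} (vanishes : ∀ y → y ≢ x → f y ≡ + 0) where

  ∑-vanishing : ∀ {l} → All (x ≢_) l → ∑ l f ≡ + 0
  ∑-vanishing []           = refl
  ∑-vanishing (x≢y ∷ x≢ys) = cong₂ _+_ (vanishes _ (x≢y ∘ sym)) (∑-vanishing x≢ys)

  ∑-supported-at : ∀ {l} → Unique l → x ∈ l → ∑ l f ≡ f x
  ∑-supported-at (x∉l ∷ _) (here refl) =
    trans (cong (_+_ (f x)) (∑-vanishing x∉l)) (ℤ.+-identityʳ (f x))
  ∑-supported-at (y∉l ∷ l-unique) (there x∈l) =
    trans (cong₂ _+_ (vanishes _ (lookup y∉l x∈l)) (∑-supported-at l-unique x∈l)) (ℤ.+-identityˡ (f x))

∑-squares : ∀ (l : List I) (f : I → ℤ) →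
            ∑ l (λ x → f x * f x) ≡ + sum (map (λ x → ∣ f x ∣ ℕ.* ∣ f x ∣) l)
∑-squares []      f = refl
∑-squares (x ∷ l) f = cong₂ _+_ (square≡+∣∣*∣∣ (f x)) (∑-squares l f)

sum-map≡0⇒≡0 : ∀ (g : I → ℕ) {l x} → sum (map g l) ≡ 0 → x ∈ l → g x ≡ 0
sum-map≡0⇒≡0 g {y ∷ l} eq (here refl)  = ℕ.m+n≡0⇒m≡0 (g y) eq
sum-map≡0⇒≡0 g {y ∷ l} eq (there x∈l) = sum-map≡0⇒≡0 g (ℕ.m+n≡0⇒n≡0 (g y) eq) x∈l

∑-squares≡0⇒≡0 : ∀ (l : List I) (f : I → ℤ) → ∑ l (λ x → f x * f x) ≡ + 0 →
                 ∀ {x} → x ∈ l → f x ≡ + 0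
∑-squares≡0⇒≡0 l f eq x∈l =
  ℤ.∣i∣≡0⇒i≡0 (reduce (ℕ.m*n≡0⇒m≡0∨n≡0 _ ∣fx∣²≡0))
  where
  ∣fx∣²≡0 = sum-map≡0⇒≡0 _ (ℤ.+-injective (trans (sym (∑-squares l f)) eq)) x∈l

module GroupRing {c} (G : FiniteGroup c) where
  open FiniteGroup G

  group : Group c c
  group = record
    { Carrier = Carrier
    ; _≈_     = _≡_
    ; _∙_     = _∙_
    ; ε       = e
    ; _⁻¹     = inv
    ; isGroup = record
      { isMonoid = record
        { isSemigroup = record
          { isMagma = record { isEquivalence = isEquivalence ; ∙-cong = cong₂ _∙_ }
          ; assoc   = assoc
          }
        ; identity = identityˡ , identityʳ
        }
      ; inverse = inverseˡ , inverseʳ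
      ; ⁻¹-cong = cong inv
      }
    }

  open GroupProperties group
    using (\\-leftDividesˡ; \\-leftDividesʳ; //-rightDividesˡ; ⁻¹-involutive; ⁻¹-anti-homo-∙; ε⁻¹≈ε)

  δ : Carrier → Carrier → ℤ → ℤ
  δ x y v = if does (x ≟ y) then v else + 0

  δ-≡ : ∀ {x y} v → x ≡ y → δ x y v ≡ v
  δ-≡ {x} {y} v x≡y = cong (if_then v else + 0) (dec-true (x ≟ y) x≡y)

  δ-≢ : ∀ {x y} v → x ≢ y → δ x y v ≡ + 0
  δ-≢ {x} {y} v x≢y = cong (if_then v else + 0) (dec-false (x ≟ y) x≢y)

  ∑G-supported-at : ∀ x {f : Carrier → ℤ} → (∀ y → y ≢ x → f y ≡ + 0) → ∑ elems f ≡ f x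
  ∑G-supported-at x vanishes = ∑-supported-at vanishes elems-unique (elems-complete x)

  -- Both sides equal ∑_h ∑_k δ(k, σ h) f(k), summed in the two orders.
  ∑G-reindex : ∀ (σ τ : Carrier → Carrier) → (∀ h → τ (σ h) ≡ h) → (∀ k → σ (τ k) ≡ k) →
               ∀ f → ∑ elems (f ∘ σ) ≡ ∑ elems f
  ∑G-reindex σ τ τσ στ f = begin
    ∑ elems (f ∘ σ)                                  ≡⟨ ∑-cong elems (sym ∘ sum-over-k) ⟩
    ∑ elems (λ h → ∑ elems (λ k → δ k (σ h) (f k)))  ≡⟨ ∑-swap elems elems (λ h k → δ k (σ h) (f k)) ⟩
    ∑ elems (λ k → ∑ elems (λ h → δ k (σ h) (f k)))  ≡⟨ ∑-cong elems sum-over-h ⟩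
    ∑ elems f                                        ∎
    where
    open ≡-Reasoning
    sum-over-k : ∀ h → ∑ elems (λ k → δ k (σ h) (f k)) ≡ f (σ h)
    sum-over-k h = trans (∑G-supported-at (σ h) (λ k → δ-≢ (f k))) (δ-≡ (f (σ h)) refl)
    k≡σh⇒h≡τk : ∀ {h k} → k ≡ σ h → h ≡ τ k
    k≡σh⇒h≡τk {h} k≡σh = trans (sym (τσ h)) (cong τ (sym k≡σh))
    sum-over-h : ∀ k → ∑ elems (λ h → δ k (σ h) (f k)) ≡ f k
    sum-over-h k = trans (∑G-supported-at (τ k) (λ h h≢τk → δ-≢ (f k) (h≢τk ∘ k≡σh⇒h≡τk)))
                         (δ-≡ (f k) (sym (στ k)))

  ∑G-translateˡ : ∀ g (f : Carrier → ℤ) → ∑ elems (λ h → f (g ∙ h)) ≡ ∑ elems f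
  ∑G-translateˡ g = ∑G-reindex (g ∙_) (inv g ∙_) (\\-leftDividesʳ g) (\\-leftDividesˡ g)

  ∑G-inv : ∀ (f : Carrier → ℤ) → ∑ elems (f ∘ inv) ≡ ∑ elems f
  ∑G-inv = ∑G-reindex inv inv ⁻¹-involutive ⁻¹-involutive

  infix  4 _≈_
  infixl 7 _⊛_
  infix  8 _⁽⁻¹⁾

  _≈_ : ℤG G → ℤG G → Set c
  _≈_ = _≈G_ G

  _⊛_ : ℤG G → ℤG G → ℤG G
  _⊛_ = _⋆_ G

  _⁽⁻¹⁾ : ℤG G → ℤG G
  (a ⁽⁻¹⁾) g = a (inv g)

  Ĝ : ℤG G
  Ĝ = ⟦_⟧ G (fullSet G)

  module ≈-Reasoning = SetoidReasoning (Carrier →-setoid ℤ)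
  open Setoid (Carrier →-setoid ℤ) using () renaming (trans to ≈-trans)

  ⊛-congˡ : ∀ a {b b′} → b ≈ b′ → a ⊛ b ≈ a ⊛ b′
  ⊛-congˡ a b≈b′ g = ∑-cong elems (λ h → cong (a h *_) (b≈b′ (inv h ∙ g)))

  ⊛-congʳ : ∀ a {b b′} → b ≈ b′ → b ⊛ a ≈ b′ ⊛ a
  ⊛-congʳ a b≈b′ g = ∑-cong elems (λ h → cong (_* a (inv h ∙ g)) (b≈b′ h))

  ⊛-identityʳ : ∀ a → a ⊛ eG G ≈ a
  ⊛-identityʳ a g = begin
    (a ⊛ eG G) g                    ≡⟨ ∑G-supported-at g vanishes ⟩
    a g * δ (inv g ∙ g) e (+ 1)     ≡⟨ cong (a g *_) (δ-≡ (+ 1) (inverseˡ g)) ⟩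
    a g * + 1                       ≡⟨ ℤ.*-identityʳ (a g) ⟩
    a g                             ∎
    where
    open ≡-Reasoning
    h⁻¹g≡e⇒h≡g : ∀ h → inv h ∙ g ≡ e → h ≡ g
    h⁻¹g≡e⇒h≡g h eq = trans (sym (identityʳ h)) (trans (cong (h ∙_) (sym eq)) (\\-leftDividesˡ h g))
    vanishes : ∀ h → h ≢ g → a h * δ (inv h ∙ g) e (+ 1) ≡ + 0
    vanishes h h≢g = trans (cong (a h *_) (δ-≢ (+ 1) (h≢g ∘ h⁻¹g≡e⇒h≡g h))) (ℤ.*-zeroʳ (a h))

  ⊛-identityˡ : ∀ a → eG G ⊛ a ≈ a
  ⊛-identityˡ a g = begin
    (eG G ⊛ a) g                  ≡⟨ ∑G-supported-at e vanishes ⟩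
    δ e e (+ 1) * a (inv e ∙ g)   ≡⟨ cong₂ _*_ (δ-≡ (+ 1) refl) (cong a e⁻¹g≡g) ⟩
    + 1 * a g                     ≡⟨ ℤ.*-identityˡ (a g) ⟩
    a g                           ∎
    where
    open ≡-Reasoning
    e⁻¹g≡g : inv e ∙ g ≡ g
    e⁻¹g≡g = trans (cong (_∙ g) ε⁻¹≈ε) (identityˡ g)
    vanishes : ∀ h → h ≢ e → δ h e (+ 1) * a (inv h ∙ g) ≡ + 0
    vanishes h h≢e = trans (cong (_* a (inv h ∙ g)) (δ-≢ (+ 1) h≢e)) (ℤ.*-zeroˡ (a (inv h ∙ g)))

  ⊛-assoc : ∀ a b d → (a ⊛ b) ⊛ d ≈ a ⊛ (b ⊛ d)
  ⊛-assoc a b d g = begin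
    ((a ⊛ b) ⊛ d) g
      ≡⟨ ∑-cong elems (λ h → sym (∑-*ʳ elems (d (inv h ∙ g)) (λ k → a k * b (inv k ∙ h)))) ⟩
    ∑ elems (λ h → ∑ elems (λ k → a k * b (inv k ∙ h) * d (inv h ∙ g)))
      ≡⟨ ∑-swap elems elems (λ h k → a k * b (inv k ∙ h) * d (inv h ∙ g)) ⟩
    ∑ elems (λ k → ∑ elems (λ h → a k * b (inv k ∙ h) * d (inv h ∙ g)))
      ≡⟨ ∑-cong elems inner ⟩
    (a ⊛ (b ⊛ d)) g
      ∎
    where
    open ≡-Reasoning
    inner : ∀ k → ∑ elems (λ h → a k * b (inv k ∙ h) * d (inv h ∙ g)) ≡ a k * (b ⊛ d) (inv k ∙ g)
    inner k = begin
      ∑ elems (λ h → a k * b (inv k ∙ h) * d (inv h ∙ g))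
        ≡⟨ ∑-cong elems (λ h → ℤ.*-assoc (a k) _ _) ⟩
      ∑ elems (λ h → a k * (b (inv k ∙ h) * d (inv h ∙ g)))
        ≡⟨ ∑-*ˡ elems (a k) _ ⟩
      a k * ∑ elems (λ h → b (inv k ∙ h) * d (inv h ∙ g))
        ≡⟨ cong (a k *_) (sym (∑G-translateˡ k (λ h → b (inv k ∙ h) * d (inv h ∙ g)))) ⟩
      a k * ∑ elems (λ h → b (inv k ∙ (k ∙ h)) * d (inv (k ∙ h) ∙ g))
        ≡⟨ cong (a k *_) (∑-cong elems (λ h → cong₂ _*_ (cong b (\\-leftDividesʳ k h)) (cong d (shift h)))) ⟩
      a k * (b ⊛ d) (inv k ∙ g)
        ∎
      where
      shift : ∀ h → inv (k ∙ h) ∙ g ≡ inv h ∙ (inv k ∙ g)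
      shift h = trans (cong (_∙ g) (⁻¹-anti-homo-∙ k h)) (assoc (inv h) (inv k) g)

  ⁽⁻¹⁾-involutive : ∀ a → a ⁽⁻¹⁾ ⁽⁻¹⁾ ≈ a
  ⁽⁻¹⁾-involutive a g = cong a (⁻¹-involutive g)

  ⁽⁻¹⁾-anti-homo-⊛ : ∀ a b → (a ⊛ b) ⁽⁻¹⁾ ≈ b ⁽⁻¹⁾ ⊛ a ⁽⁻¹⁾
  ⁽⁻¹⁾-anti-homo-⊛ a b g = begin
    ∑ elems (λ h → a h * b (inv h ∙ inv g))
      ≡⟨ ∑-cong elems (λ h → trans (ℤ.*-comm (a h) _)
                                    (cong₂ _*_ (cong b (sym (⁻¹-anti-homo-∙ g h))) (cong a (sym (untranslate h))))) ⟩
    ∑ elems (λ h → b (inv (g ∙ h)) * a (inv (inv (g ∙ h) ∙ g)))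
      ≡⟨ ∑G-translateˡ g (λ h → b (inv h) * a (inv (inv h ∙ g))) ⟩
    (b ⁽⁻¹⁾ ⊛ a ⁽⁻¹⁾) g
      ∎
    where
    open ≡-Reasoning
    untranslate : ∀ h → inv (inv (g ∙ h) ∙ g) ≡ h
    untranslate h = begin
      inv (inv (g ∙ h) ∙ g)    ≡⟨ cong (λ x → inv (x ∙ g)) (⁻¹-anti-homo-∙ g h) ⟩
      inv (inv h ∙ inv g ∙ g)  ≡⟨ cong inv (//-rightDividesˡ g (inv h)) ⟩
      inv (inv h)              ≡⟨ ⁻¹-involutive h ⟩
      h                        ∎

  ⊛-comm-at-e : ∀ a b → (a ⊛ b) e ≡ (b ⊛ a) e
  ⊛-comm-at-e a b = trans (∑-cong elems swap) (∑G-inv (λ h → b h * a (inv h ∙ e)))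
    where
    swap : ∀ h → a h * b (inv h ∙ e) ≡ b (inv h) * a (inv (inv h) ∙ e)
    swap h = trans (ℤ.*-comm (a h) _)
                   (cong₂ _*_ (cong b (identityʳ (inv h)))
                              (cong a (sym (trans (identityʳ _) (⁻¹-involutive h)))))

  ⊛⁽⁻¹⁾-at-e : ∀ a → (a ⊛ a ⁽⁻¹⁾) e ≡ ∑ elems (λ h → a h * a h)
  ⊛⁽⁻¹⁾-at-e a =
    ∑-cong elems (λ h → cong (λ x → a h * a x) (trans (cong inv (identityʳ (inv h))) (⁻¹-involutive h)))

  Ĝ-central : ∀ a → a ⊛ Ĝ ≈ Ĝ ⊛ a
  Ĝ-central a g = begin
    ∑ elems (λ h → a h * + 1)            ≡⟨ ∑-cong elems (λ h → ℤ.*-identityʳ (a h)) ⟩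
    ∑ elems a                            ≡⟨ ∑G-reindex (λ h → inv h ∙ g) (λ k → g ∙ inv k) τσ στ a ⟨
    ∑ elems (λ h → a (inv h ∙ g))        ≡⟨ ∑-cong elems (λ h → ℤ.*-identityˡ (a (inv h ∙ g))) ⟨
    ∑ elems (λ h → + 1 * a (inv h ∙ g))  ∎
    where
    open ≡-Reasoning
    τσ : ∀ h → g ∙ inv (inv h ∙ g) ≡ h
    τσ h = begin
      g ∙ inv (inv h ∙ g)         ≡⟨ cong (g ∙_) (⁻¹-anti-homo-∙ (inv h) g) ⟩
      g ∙ (inv g ∙ inv (inv h))   ≡⟨ \\-leftDividesˡ g (inv (inv h)) ⟩
      inv (inv h)                 ≡⟨ ⁻¹-involutive h ⟩
      h                           ∎
    στ : ∀ k → inv (g ∙ inv k) ∙ g ≡ k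
    στ k = begin
      inv (g ∙ inv k) ∙ g         ≡⟨ cong (_∙ g) (⁻¹-anti-homo-∙ g (inv k)) ⟩
      inv (inv k) ∙ inv g ∙ g     ≡⟨ //-rightDividesˡ g (inv (inv k)) ⟩
      inv (inv k)                 ≡⟨ ⁻¹-involutive k ⟩
      k                           ∎

  ⊛-distribˡ-⊖ : ∀ a b d → a ⊛ (_⊖_ G b d) ≈ _⊖_ G (a ⊛ b) (a ⊛ d)
  ⊛-distribˡ-⊖ a b d g =
    trans (∑-cong elems (λ h → distrib (a h) (b (inv h ∙ g)) (d (inv h ∙ g))))
          (∑-- elems (λ h → a h * b (inv h ∙ g)) (λ h → a h * d (inv h ∙ g)))
    where
    distrib : ∀ x y z → x * (y - z) ≡ x * y - x * z
    distrib = solve-∀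

  ⊛-distribʳ-⊖ : ∀ a b d → (_⊖_ G b d) ⊛ a ≈ _⊖_ G (b ⊛ a) (d ⊛ a)
  ⊛-distribʳ-⊖ a b d g =
    trans (∑-cong elems (λ h → distrib (a (inv h ∙ g)) (b h) (d h)))
          (∑-- elems (λ h → b h * a (inv h ∙ g)) (λ h → d h * a (inv h ∙ g)))
    where
    distrib : ∀ x y z → (y - z) * x ≡ y * x - z * x
    distrib = solve-∀

  rdsRHS : ℕ → ℕ → ℤG G → ℤG G
  rdsRHS k l ν = _⊕_ G (_·_ G (+ k) (eG G)) (_·_ G (+ l) (_⊖_ G Ĝ ν))

  ⊛-rdsRHS : ∀ k l ν a g → (a ⊛ rdsRHS k l ν) g ≡ + k * a g + + l * ((a ⊛ Ĝ) g - (a ⊛ ν) g)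
  ⊛-rdsRHS k l ν a g = begin
    (a ⊛ rdsRHS k l ν) g
      ≡⟨ ∑-cong elems (λ h → distrib (+ k) (+ l) (a h) (eG G (inv h ∙ g)) (Ĝ (inv h ∙ g)) (ν (inv h ∙ g))) ⟩
    ∑ elems (λ h → + k * (a h * eG G (inv h ∙ g)) + + l * (a h * Ĝ (inv h ∙ g) - a h * ν (inv h ∙ g)))
      ≡⟨ ∑-linear elems (+ k) (+ l) (λ h → a h * eG G (inv h ∙ g))
                                    (λ h → a h * Ĝ (inv h ∙ g)) (λ h → a h * ν (inv h ∙ g)) ⟩
    + k * (a ⊛ eG G) g + + l * ((a ⊛ Ĝ) g - (a ⊛ ν) g)
      ≡⟨ cong (λ t → + k * t + + l * ((a ⊛ Ĝ) g - (a ⊛ ν) g)) (⊛-identityʳ a g) ⟩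
    + k * a g + + l * ((a ⊛ Ĝ) g - (a ⊛ ν) g)
      ∎
    where
    open ≡-Reasoning
    distrib : ∀ K L x E U V → x * (K * E + L * (U - V)) ≡ K * (x * E) + L * (x * U - x * V)
    distrib = solve-∀

  rdsRHS-⊛ : ∀ k l ν a g → (rdsRHS k l ν ⊛ a) g ≡ + k * a g + + l * ((Ĝ ⊛ a) g - (ν ⊛ a) g)
  rdsRHS-⊛ k l ν a g = begin
    (rdsRHS k l ν ⊛ a) g
      ≡⟨ ∑-cong elems (λ h → distrib (+ k) (+ l) (a (inv h ∙ g)) (eG G h) (Ĝ h) (ν h)) ⟩
    ∑ elems (λ h → + k * (eG G h * a (inv h ∙ g)) + + l * (Ĝ h * a (inv h ∙ g) - ν h * a (inv h ∙ g)))
      ≡⟨ ∑-linear elems (+ k) (+ l) (λ h → eG G h * a (inv h ∙ g))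
                                    (λ h → Ĝ h * a (inv h ∙ g)) (λ h → ν h * a (inv h ∙ g)) ⟩
    + k * (eG G ⊛ a) g + + l * ((Ĝ ⊛ a) g - (ν ⊛ a) g)
      ≡⟨ cong (λ t → + k * t + + l * ((Ĝ ⊛ a) g - (ν ⊛ a) g)) (⊛-identityˡ a g) ⟩
    + k * a g + + l * ((Ĝ ⊛ a) g - (ν ⊛ a) g)
      ∎
    where
    open ≡-Reasoning
    distrib : ∀ K L x E U V → (K * E + L * (U - V)) * x ≡ K * (E * x) + L * (U * x - V * x)
    distrib = solve-∀

  Commute : ℤG G → ℤG G → Set c
  Commute a b = a ⊛ b ≈ b ⊛ a

  commute-refl : ∀ a → Commute a a
  commute-refl a g = refl

  commute-respʳ : ∀ a {b b′} → b ≈ b′ → Commute a b → Commute a b′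
  commute-respʳ a {b} {b′} b≈b′ ab≈ba = begin
    a ⊛ b′  ≈⟨ ⊛-congˡ a b≈b′ ⟨
    a ⊛ b   ≈⟨ ab≈ba ⟩
    b ⊛ a   ≈⟨ ⊛-congʳ a b≈b′ ⟩
    b′ ⊛ a  ∎
    where open ≈-Reasoning

  commute-⊛ : ∀ a {b d} → Commute a b → Commute a d → Commute a (b ⊛ d)
  commute-⊛ a {b} {d} ab≈ba ad≈da = begin
    a ⊛ (b ⊛ d)  ≈⟨ ⊛-assoc a b d ⟨
    a ⊛ b ⊛ d    ≈⟨ ⊛-congʳ d ab≈ba ⟩
    b ⊛ a ⊛ d    ≈⟨ ⊛-assoc b a d ⟩
    b ⊛ (a ⊛ d)  ≈⟨ ⊛-congˡ b ad≈da ⟩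
    b ⊛ (d ⊛ a)  ≈⟨ ⊛-assoc b d a ⟨
    b ⊛ d ⊛ a    ∎
    where open ≈-Reasoning

  commute-⁽⁻¹⁾ : ∀ a b → Commute a b → Commute (a ⁽⁻¹⁾) (b ⁽⁻¹⁾)
  commute-⁽⁻¹⁾ a b ab≈ba = begin
    a ⁽⁻¹⁾ ⊛ b ⁽⁻¹⁾  ≈⟨ ⁽⁻¹⁾-anti-homo-⊛ b a ⟨
    (b ⊛ a) ⁽⁻¹⁾     ≈⟨ (λ g → sym (ab≈ba (inv g))) ⟩
    (a ⊛ b) ⁽⁻¹⁾     ≈⟨ ⁽⁻¹⁾-anti-homo-⊛ a b ⟩
    b ⁽⁻¹⁾ ⊛ a ⁽⁻¹⁾  ∎
    where open ≈-Reasoning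

  commute-rdsRHS⇔commute : ∀ k l .{{_ : ℕ.NonZero l}} a ν → Commute a (rdsRHS k l ν) ⇔ Commute a ν
  commute-rdsRHS⇔commute k l a ν = mk⇔
    (λ aR≈Ra g → affine-injective (+ k * a g) ((a ⊛ Ĝ) g) (+ l)
                   (trans (sym (left g)) (trans (aR≈Ra g) (right g))))
    (λ aν≈νa g → trans (left g) (trans (cong (expansion g) (aν≈νa g)) (sym (right g))))
    where
    expansion : Carrier → ℤ → ℤ
    expansion g p = + k * a g + + l * ((a ⊛ Ĝ) g - p)
    left : ∀ g → (a ⊛ rdsRHS k l ν) g ≡ expansion g ((a ⊛ ν) g)
    left = ⊛-rdsRHS k l ν a
    right : ∀ g → (rdsRHS k l ν ⊛ a) g ≡ expansion g ((ν ⊛ a) g)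
    right g = trans (rdsRHS-⊛ k l ν a g)
                    (cong (λ t → + k * a g + + l * (t - (ν ⊛ a) g)) (sym (Ĝ-central a g)))

  square-at-e≡0⇒≡0 : ∀ b → b ⁽⁻¹⁾ ≈ b → (b ⊛ b) e ≡ + 0 → ∀ g → b g ≡ + 0
  square-at-e≡0⇒≡0 b b⁻¹≈b bb≡0 g = ∑-squares≡0⇒≡0 elems b squares≡0 (elems-complete g)
    where
    squares≡0 : ∑ elems (λ h → b h * b h) ≡ + 0
    squares≡0 = trans (sym (⊛⁽⁻¹⁾-at-e b)) (trans (⊛-congˡ b b⁻¹≈b e) bb≡0)

  -- For A = a⁽⁻¹⁾a and D = aa⁽⁻¹⁾ the hypothesis gives AA = DA; with cyclicity of the trace
  -- b ↦ b(e) this kills the trace of (A − D)², and A − D is self-adjoint.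
  commute-⊛⁽⁻¹⁾⇒commute : ∀ a → Commute (a ⁽⁻¹⁾) (a ⊛ a ⁽⁻¹⁾) → Commute a (a ⁽⁻¹⁾)
  commute-⊛⁽⁻¹⁾⇒commute a a⁻¹D≈Da⁻¹ g = sym (ℤ.i-j≡0⇒i≡j (A g) (D g) (square-at-e≡0⇒≡0 B B⁻¹≈B BB≡0 g))
    where
    D A B : ℤG G
    D = a ⊛ a ⁽⁻¹⁾
    A = a ⁽⁻¹⁾ ⊛ a
    B = _⊖_ G A D

    B⁻¹≈B : B ⁽⁻¹⁾ ≈ B
    B⁻¹≈B g = cong₂ _-_ (A⁻¹≈A g) (D⁻¹≈D g)
      where
      A⁻¹≈A : A ⁽⁻¹⁾ ≈ A
      A⁻¹≈A = ≈-trans (⁽⁻¹⁾-anti-homo-⊛ (a ⁽⁻¹⁾) a) (⊛-congˡ (a ⁽⁻¹⁾) (⁽⁻¹⁾-involutive a))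
      D⁻¹≈D : D ⁽⁻¹⁾ ≈ D
      D⁻¹≈D = ≈-trans (⁽⁻¹⁾-anti-homo-⊛ a (a ⁽⁻¹⁾)) (⊛-congʳ (a ⁽⁻¹⁾) (⁽⁻¹⁾-involutive a))

    AA≈a⁻¹D⊛a : A ⊛ A ≈ a ⁽⁻¹⁾ ⊛ D ⊛ a
    AA≈a⁻¹D⊛a = begin
      A ⊛ A                   ≈⟨ ⊛-assoc A (a ⁽⁻¹⁾) a ⟨
      A ⊛ a ⁽⁻¹⁾ ⊛ a          ≈⟨ ⊛-congʳ a (⊛-assoc (a ⁽⁻¹⁾) a (a ⁽⁻¹⁾)) ⟩
      a ⁽⁻¹⁾ ⊛ D ⊛ a          ∎
      where open ≈-Reasoning

    AA≈DA : A ⊛ A ≈ D ⊛ A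
    AA≈DA = begin
      A ⊛ A                   ≈⟨ AA≈a⁻¹D⊛a ⟩
      a ⁽⁻¹⁾ ⊛ D ⊛ a          ≈⟨ ⊛-congʳ a a⁻¹D≈Da⁻¹ ⟩
      D ⊛ a ⁽⁻¹⁾ ⊛ a          ≈⟨ ⊛-assoc D (a ⁽⁻¹⁾) a ⟩
      D ⊛ A                   ∎
      where open ≈-Reasoning

    DD≡AA-at-e : (D ⊛ D) e ≡ (A ⊛ A) e
    DD≡AA-at-e = begin
      (D ⊛ D) e               ≡⟨ ⊛-assoc a (a ⁽⁻¹⁾) D e ⟩
      (a ⊛ (a ⁽⁻¹⁾ ⊛ D)) e    ≡⟨ ⊛-comm-at-e a (a ⁽⁻¹⁾ ⊛ D) ⟩
      (a ⁽⁻¹⁾ ⊛ D ⊛ a) e      ≡⟨ AA≈a⁻¹D⊛a e ⟨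
      (A ⊛ A) e               ∎
      where open ≡-Reasoning

    BB≡0 : (B ⊛ B) e ≡ + 0
    BB≡0 = begin
      (B ⊛ B) e
        ≡⟨ ⊛-distribʳ-⊖ B A D e ⟩
      (A ⊛ B) e - (D ⊛ B) e
        ≡⟨ cong₂ _-_ (⊛-distribˡ-⊖ A A D e) (⊛-distribˡ-⊖ D A D e) ⟩
      ((A ⊛ A) e - (A ⊛ D) e) - ((D ⊛ A) e - (D ⊛ D) e)
        ≡⟨ cong₂ _-_ (cong₂ _-_ (AA≈DA e) (⊛-comm-at-e A D)) (cong (t -_) (trans DD≡AA-at-e (AA≈DA e))) ⟩
      (t - t) - (t - t)
        ≡⟨ cong₂ _-_ (ℤ.+-inverseʳ t) (ℤ.+-inverseʳ t) ⟩
      + 0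
        ∎
      where
      open ≡-Reasoning
      t : ℤ
      t = (D ⊛ A) e

  ⟦⟧⁽⁻¹⁾-subgroup : ∀ N → IsSubgroup G N → ⟦_⟧ G N ⁽⁻¹⁾ ≈ ⟦_⟧ G N
  ⟦⟧⁽⁻¹⁾-subgroup N N≤G g = cong (if_then + 1 else + 0) (⇔→≡ (mk⇔ inv-back (inv-closed g)))
    where
    open IsSubgroup N≤G
    inv-back : N (inv g) ≡ true → N g ≡ true
    inv-back Ng⁻¹ = subst (λ x → N x ≡ true) (⁻¹-involutive g) (inv-closed (inv g) Ng⁻¹)

lemma3p2 : ∀ {c : Level} (G : FiniteGroup c) (N X : Subset G) (m n k lam : ℕ)
    → IsRDS G N X m n k lam
    → (IsICommuting G X → _≈G_ G (_⋆_ G (⟦_⟧ G X) (⟦_⟧ G N)) (_⋆_ G (⟦_⟧ G N) (⟦_⟧ G X)))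
      × (_≈G_ G (_⋆_ G (⟦_⟧ G X) (⟦_⟧ G N)) (_⋆_ G (⟦_⟧ G N) (⟦_⟧ G X)) → IsICommuting G X)
lemma3p2 G N X m n k lam rds = forward , backward
  where
  open GroupRing G
  open IsRDS rds
  instance
    λ≢0 : ℕ.NonZero lam
    λ≢0 = ℕ.>-nonZero λ-pos

  x ν : ℤG G
  x = ⟦_⟧ G X
  ν = ⟦_⟧ G N

  forward : Commute x (x ⁽⁻¹⁾) → Commute x ν
  forward xx⁻¹≈x⁻¹x = Equivalence.to (commute-rdsRHS⇔commute k lam x ν) x-commutes-with-R
    where
    x-commutes-with-R : Commute x (rdsRHS k lam ν)
    x-commutes-with-R = commute-respʳ x rds-eq (commute-⊛ x {x} {x ⁽⁻¹⁾} (commute-refl x) xx⁻¹≈x⁻¹x)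

  backward : Commute x ν → Commute x (x ⁽⁻¹⁾)
  backward xν≈νx = commute-⊛⁽⁻¹⁾⇒commute x x⁻¹-commutes-with-xx⁻¹
    where
    x⁻¹-commutes-with-ν : Commute (x ⁽⁻¹⁾) ν
    x⁻¹-commutes-with-ν = commute-respʳ (x ⁽⁻¹⁾) (⟦⟧⁽⁻¹⁾-subgroup N N-subgroup) (commute-⁽⁻¹⁾ x ν xν≈νx)
    x⁻¹-commutes-with-xx⁻¹ : Commute (x ⁽⁻¹⁾) (x ⊛ x ⁽⁻¹⁾)
    x⁻¹-commutes-with-xx⁻¹ = commute-respʳ (x ⁽⁻¹⁾) (λ g → sym (rds-eq g))
      (Equivalence.from (commute-rdsRHS⇔commute k lam (x ⁽⁻¹⁾) ν) x⁻¹-commutes-with-ν)
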